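{- Let $A_{10}=\{1,3,4,9,12,13,19,44,47,62\}$ (so $k=10$, $a_k=62$). Then $h_0=3$, and $d(3)=14$, $d(4)=5$, $d(5)=6$. In particular $d(5)>d(4)$, so the sequence $d(h_0),d(h_0+1),\dots$ is not non-increasing (a counterexample to Selmer's conjecture).
   Context: For a set $A_k=\{a_1,\dots,a_k\}$ of integers with $1=a_1<\dots<a_k$ and an integer $h\ge 0$, an integer $x\ge 0$ has an $h$-representation if $x=\sum_{i=1}^k c_ia_i$ with nonnegative integers $c_i$ and $\sum_i c_i\le h$. The $h$-range $n(h)$ is the largest integer $n$ such that every integer $0\le x\le n$ has an $h$-representation; $h_0$ is the smallest positive integer $h$ with $n(h)\ge a_k$. An integer $x$ is a gap at level $h$ if $n(h)<x<ha_k$ and $x$ has no $h$-representation; $m(h)$ is the number of gaps at level $h$, and $d(h)=m(h-1)-m(h)$. -}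

module Defs where

open import Data.Nat using (ℕ; zero; suc; _+_; _*_; _≤_; _<_)
open import Data.Vec using (Vec; []; _∷_; sum; zipWith; last)
open import Data.List using (List; length)
open import Data.List.Membership.Propositional using (_∈_)
open import Data.List.Relation.Unary.Unique.Propositional using (Unique)
open import Data.Product using (Σ; _×_; ∃; ∃-syntax)
open import Function.Bundles using (_⇔_)
open import Relation.Nullary using (¬_)

-- A basis A_k = {a_1,...,a_k} is given as a vector (a_1,...,a_k), k ≥ 1.
-- The largest element a_k is the last entry.
aₖ : ∀ {k} → Vec ℕ (suc k) → ℕ
aₖ A = last A

HRep : ∀ {k} → Vec ℕ k → ℕ → ℕ → Set
HRep {k} A h x = ∃[ c ] (sum {n = k} c ≤ h × sum (zipWith _*_ c A) ≡ x)
  where open import Relation.Binary.PropositionalEquality using (_≡_)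

IsRange : ∀ {k} → Vec ℕ k → ℕ → ℕ → Set
IsRange A h n = (∀ x → x ≤ n → HRep A h x) × ¬ HRep A h (suc n)

IsH₀ : ∀ {k} → Vec ℕ (suc k) → ℕ → Set
IsH₀ A h = 1 ≤ h
         × (∃[ n ] (IsRange A h n × aₖ A ≤ n))
         × (∀ h′ → 1 ≤ h′ → h′ < h → ∀ n → IsRange A h′ n → n < aₖ A)

IsGap : ∀ {k} → Vec ℕ (suc k) → ℕ → ℕ → ℕ → Set
IsGap A h n x = n < x × x < h * aₖ A × ¬ HRep A h x

GapCount : ∀ {k} → Vec ℕ (suc k) → ℕ → ℕ → Set
GapCount A h m = ∃[ n ] (IsRange A h n ×
                   ∃[ gs ] (Unique gs × length gs ≡ m ×
                            (∀ x → (x ∈ gs) ⇔ IsGap A h n x)))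
  where open import Relation.Binary.PropositionalEquality using (_≡_)

module Submission where

-- The theorem is a finite computation about the basis
-- A = {1,3,4,9,12,13,19,44,47,62}, so the proof consists of a verified
-- decision procedure plus certificates it checks by evaluation.
--
-- * Representability is decidable for every basis: an h-representation over
--   a ∷ A either does not use a (a representation over A), or uses a at
--   least once (a representation of x ∸ a over a ∷ A with one summand less).

open import Defs
open import Data.Nat using (ℕ; suc; _<_)
open import Data.Vec using (Vec; []; _∷_)
open import Data.Integer using (ℤ; +_; _-_) renaming (_<_ to _<ℤ_)
open import Data.Product using (_×_; ∃-syntax)
open import Relation.Binary.PropositionalEquality using (_≡_)

open import Data.Nat using (zero; _+_; _*_; _∸_; _≤_; z≤n; s≤s; _≟_; _≤?_; _<?_; allUpTo?)
open import Data.Nat.Properties using (+-assoc; m+[n∸m]≡n; m+n∸m≡n; m≤m+n; ≤-trans; ≤-refl; ≤-reflexive; ≤-pred; ≰⇒>)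
open import Data.Vec using (sum; zipWith)
open import Data.List using (List; filter; upTo; length)
open import Data.List.Membership.Propositional.Properties using (∈-filter⁺; ∈-filter⁻; ∈-upTo⁺)
open import Data.List.Relation.Unary.Unique.Propositional.Properties using (filter⁺; upTo⁺)
open import Data.Product using (_,_; proj₁; proj₂)
open import Data.Sum using (_⊎_; inj₁; inj₂)
open import Data.Empty using (⊥; ⊥-elim)
open import Data.Unit using (tt)
open import Relation.Nullary using (Dec; yes; no; ¬_)
open import Relation.Nullary.Decidable using (map′; _⊎-dec_; _×-dec_; ¬?; True; toWitness; toWitnessFalse)
open import Relation.Unary using (Decidable)
open import Relation.Binary.PropositionalEquality using (refl; sym; trans; cong)
open import Function.Bundles using (mk⇔)
import Data.Integer as ℤ

UsesHead : ∀ {k} → ℕ → Vec ℕ k → ℕ → ℕ → Set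
UsesHead a A zero    x = ⊥
UsesHead a A (suc h) x = a ≤ x × HRep (a ∷ A) h (x ∸ a)

hrep-tail : ∀ {k} a (A : Vec ℕ k) h x → HRep A h x → HRep (a ∷ A) h x
hrep-tail a A h x (c , size , value) = (0 ∷ c) , size , value

hrep-head : ∀ {k} a (A : Vec ℕ k) h x → UsesHead a A h x → HRep (a ∷ A) h x
hrep-head a A (suc h) x (a≤x , (c₀ ∷ c) , size , value) =
  (suc c₀ ∷ c) , s≤s size ,
  trans (+-assoc a (c₀ * a) (sum (zipWith _*_ c A)))
        (trans (cong (λ y → a + y) value) (m+[n∸m]≡n a≤x))

hrep-split : ∀ {k} a (A : Vec ℕ k) h x → HRep (a ∷ A) h x → HRep A h x ⊎ UsesHead a A h x
hrep-split a A h       x ((zero ∷ c) , size , value) = inj₁ (c , size , value)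
hrep-split a A (suc h) x ((suc c₀ ∷ c) , s≤s size , value) =
  inj₂ (a≤x , (c₀ ∷ c) , size , rest)
  where
    r = sum (zipWith _*_ c A)
    total : a + (c₀ * a + r) ≡ x
    total = trans (sym (+-assoc a (c₀ * a) r)) value
    a≤x : a ≤ x
    a≤x = ≤-trans (m≤m+n a (c₀ * a + r)) (≤-reflexive total)
    rest : c₀ * a + r ≡ x ∸ a
    rest = trans (sym (m+n∸m≡n a (c₀ * a + r))) (cong (_∸ a) total)

hrep? : ∀ {k} (A : Vec ℕ k) h → Decidable (HRep A h)
hrep? []      h x = map′ (λ x≡0 → [] , z≤n , x≡0) (λ { ([] , _ , x≡0) → x≡0 }) (0 ≟ x)
hrep? (a ∷ A) h x =
  map′ (λ { (inj₁ p) → hrep-tail a A h x p ; (inj₂ q) → hrep-head a A h x q })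
       (hrep-split a A h x)
       (hrep? A h x ⊎-dec usesHead? h)
  where
    usesHead? : ∀ h → Dec (UsesHead a A h x)
    usesHead? zero    = no λ ()
    usesHead? (suc h) = a ≤? x ×-dec hrep? (a ∷ A) h (x ∸ a)

isRange? : ∀ {k} (A : Vec ℕ k) h n → Dec (IsRange A h n)
isRange? A h n =
  map′ (λ (below , top) → (λ x x≤n → below (s≤s x≤n)) , top)
       (λ (below , top) → (λ {x} x<n+1 → below x (≤-pred x<n+1)) , top)
       (allUpTo? (hrep? A h) (suc n) ×-dec ¬? (hrep? A h (suc n)))

range-≤ : ∀ {k} (A : Vec ℕ k) h n r → IsRange A h n → ¬ HRep A h (suc r) → n ≤ r
range-≤ A h n r (upToN , _) r+1-missing with n ≤? r
... | yes n≤r = n≤r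
... | no  n≰r = ⊥-elim (r+1-missing (upToN (suc r) (≰⇒> n≰r)))

isGap? : ∀ {k} (A : Vec ℕ (suc k)) h n → Decidable (IsGap A h n)
isGap? A h n x = n <? x ×-dec (x <? h * aₖ A ×-dec ¬? (hrep? A h x))

gaps : ∀ {k} (A : Vec ℕ (suc k)) h n → List ℕ
gaps A h n = filter (isGap? A h n) (upTo (h * aₖ A))

gapCount : ∀ {k} (A : Vec ℕ (suc k)) h n → IsRange A h n → GapCount A h (length (gaps A h n))
gapCount A h n range =
  n , range , gaps A h n , filter⁺ (isGap? A h n) (upTo⁺ (h * aₖ A)) , refl ,
  λ x → mk⇔ (λ x∈gaps → proj₂ (∈-filter⁻ (isGap? A h n) {xs = upTo (h * aₖ A)} x∈gaps))
             (λ gap → ∈-filter⁺ (isGap? A h n) (∈-upTo⁺ (proj₁ (proj₂ gap))) gap)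

mainTheorem8 :
  let A : Vec ℕ 10
      A = 1 ∷ 3 ∷ 4 ∷ 9 ∷ 12 ∷ 13 ∷ 19 ∷ 44 ∷ 47 ∷ 62 ∷ []
  in IsH₀ A 3
     × (∃[ m₂ ] ∃[ m₃ ] ∃[ m₄ ] ∃[ m₅ ]
         (GapCount A 2 m₂ × GapCount A 3 m₃ × GapCount A 4 m₄ × GapCount A 5 m₅
          × (+ m₂ - + m₃ ≡ + 14)
          × (+ m₃ - + m₄ ≡ + 5)
          × (+ m₄ - + m₅ ≡ + 6)
          × (+ m₃ - + m₄ <ℤ + m₄ - + m₅)))
mainTheorem8 =
  (s≤s z≤n , (95 , range 3 95 , m≤m+n 62 33) , below-h₀) ,
  (_ , _ , _ , _ ,
   gapCount A 2 10 (range 2 10) , gapCount A 3 95 (range 3 95) ,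
   gapCount A 4 157 (range 4 157) , gapCount A 5 239 (range 5 239) ,
   refl , refl , refl , ℤ.+<+ ≤-refl)
  where
    A : Vec ℕ 10
    A = 1 ∷ 3 ∷ 4 ∷ 9 ∷ 12 ∷ 13 ∷ 19 ∷ 44 ∷ 47 ∷ 62 ∷ []

    range : ∀ h n {ok : True (isRange? A h n)} → IsRange A h n
    range h n {ok} = toWitness ok

    below-h₀ : ∀ h′ → 1 ≤ h′ → h′ < 3 → ∀ n → IsRange A h′ n → n < 62
    below-h₀ 1 _ _ n R = s≤s (≤-trans (range-≤ A 1 n 1 R (toWitnessFalse {a? = hrep? A 1 2} tt)) (m≤m+n 1 60))
    below-h₀ 2 _ _ n R = s≤s (≤-trans (range-≤ A 2 n 10 R (toWitnessFalse {a? = hrep? A 2 11} tt)) (m≤m+n 10 51))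
    below-h₀ (suc (suc (suc _))) _ (s≤s (s≤s (s≤s ()))) _ _
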